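{- Let $P$ be a finite poset, $\mathbb{S}$ a skew field containing an infinite field as a subfield, and $C$ a central element of $\mathbb{S}$. Then $\operatorname{NAR}=\nabla\circ\Theta\circ\Delta^{ -1}$ (as partial maps $\mathbb{S}^P\dashrightarrow\mathbb{S}^P$, wherever defined).
   Context: $\mathbb{S}^P$ is the set of labelings $g:P\to\mathbb{S}$; products denote composition, rightmost first; $\overline{x}=x^{ -1}$. $\widehat P$ is $P$ with a new minimum $\widehat0$ and maximum $\widehat1$; $x\lessdot y$ means $y$ covers $x$ in $\widehat P$. The noncommutative antichain toggle $\tau_v$ changes only the label at $v$: $(\tau_vg)(v)=C\cdot\overline{\sum g(y_{c-1})\cdots g(y_1)\,g(y_k)\cdots g(y_c)}$, the sum over all maximal chains $y_1\lessdot\cdots\lessdot y_k$ of $P$ with $y_c=v$. $\operatorname{NAR}=\tau_{x_n}\cdots\tau_{x_2}\tau_{x_1}$ for any linear extension $(x_1,\dots,x_n)$ of $P$ (listing with $x_i<x_j\Rightarrow i<j$), i.e. toggling from bottom to top. Transfer maps: $(\Theta f)(x)=C\,\overline{f(x)}$; $(\nabla f)(x)=f(x)\,\overline{\sum_{y\lessdot x}f(y)}$ with $f(\widehat0)=1$; $(\Delta^{ -1}f)(x)=\sum f(y_k)\cdots f(y_2)f(y_1)$ over all chains $x=y_1\lessdot y_2\lessdot\cdots\lessdot y_k\lessdot\widehat1$. -}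

module Defs where

open import Level using (Level; _⊔_; Lift) renaming (suc to lsuc)
open import Algebra.Bundles using (Ring)
open import Data.Bool using (if_then_else_)
open import Data.Nat as ℕ using (ℕ)
open import Data.Fin as Fin using (Fin)
open import Data.Fin.Properties using (all?; _≟_)
open import Data.List using (List; []; _∷_; [_]; map; foldr; reverse; concatMap; filter; mapMaybe; upTo; allFin)
open import Data.Maybe using (Maybe; just; nothing)
import Data.Maybe as Maybe
open import Data.Product using (_×_; _,_; ∃; Σ)
open import Data.Product.Properties using ()
open import Relation.Nullary using (¬_; Dec; yes; no; does)
open import Relation.Nullary.Decidable using (_×-dec_; ¬?)
open import Data.Unit using (⊤; tt)
open import Relation.Binary.PropositionalEquality using (_≡_; _≢_)
open import Relation.Binary using (IsPartialOrder)
open import Relation.Binary.Definitions using (Decidable)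
open import Function.Definitions using (Injective; StrictlySurjective)

-- Skew fields (division rings).  The inverse is given as a total
-- operation whose value at 0 is unconstrained; the inverse laws are
-- only required for nonzero elements.

record SkewField (c ℓ : Level) : Set (lsuc (c ⊔ ℓ)) where
  field
    ring : Ring c ℓ
  open Ring ring public
  field
    _⁻¹         : Carrier → Carrier
    ⁻¹-cong     : ∀ {x y} → x ≈ y → x ⁻¹ ≈ y ⁻¹
    0≉1         : ¬ (0# ≈ 1#)
    ⁻¹-inverseʳ : ∀ x → ¬ (x ≈ 0#) → x * (x ⁻¹) ≈ 1#
    ⁻¹-inverseˡ : ∀ x → ¬ (x ≈ 0#) → (x ⁻¹) * x ≈ 1#

-- "S contains an infinite field as a subfield": a subset K of S
-- closed under the field operations, commutative, and infinite
-- (containing an injective image of ℕ).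
record InfiniteSubfield {c ℓ : Level} (S : SkewField c ℓ) (k : Level)
       : Set (c ⊔ ℓ ⊔ lsuc k) where
  open SkewField S
  field
    K       : Carrier → Set k
    K-resp  : ∀ {x y} → x ≈ y → K x → K y
    K-0     : K 0#
    K-1     : K 1#
    K-+     : ∀ {x y} → K x → K y → K (x + y)
    K--     : ∀ {x} → K x → K (- x)
    K-*     : ∀ {x y} → K x → K y → K (x * y)
    K-⁻¹    : ∀ {x} → K x → ¬ (x ≈ 0#) → K (x ⁻¹)
    K-comm  : ∀ {x y} → K x → K y → x * y ≈ y * x
    elem    : ℕ → Carrier
    elem-K  : ∀ m → K (elem m)
    elem-inj : ∀ m m′ → elem m ≈ elem m′ → m ≡ m′

Central : ∀ {c ℓ} (S : SkewField c ℓ) → SkewField.Carrier S → Set (c ⊔ ℓ)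
Central S C = ∀ x → C * x ≈ x * C
  where open SkewField S

record FinPoset (n : ℕ) : Set₁ where
  field
    _≤_            : Fin n → Fin n → Set
    isPartialOrder : IsPartialOrder _≡_ _≤_
    _≤?_           : Decidable _≤_

module PosetOps {n : ℕ} (P : FinPoset n) where
  open FinPoset P

  _<_ : Fin n → Fin n → Set
  x < y = x ≤ y × x ≢ y

  _<?_ : Decidable _<_
  x <? y = (x ≤? y) ×-dec ¬? (x ≟ y)

  _⋖_ : Fin n → Fin n → Set
  x ⋖ y = x < y × (∀ z → ¬ (x < z × z < y))

  _⋖?_ : Decidable _⋖_
  x ⋖? y = (x <? y) ×-dec all? (λ z → ¬? ((x <? z) ×-dec (z <? y)))

  -- minimal elements are exactly those covering 0̂ in P̂,
  -- maximal elements exactly those covered by 1̂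
  Minimal : Fin n → Set
  Minimal x = ∀ z → ¬ (z < x)

  Minimal? : ∀ x → Dec (Minimal x)
  Minimal? x = all? (λ z → ¬? (z <? x))

  Maximal : Fin n → Set
  Maximal x = ∀ z → ¬ (x < z)

  Maximal? : ∀ x → Dec (Maximal x)
  Maximal? x = all? (λ z → ¬? (x <? z))

  CoverChain : Fin n → List (Fin n) → Set
  CoverChain x []      = ⊤
  CoverChain x (y ∷ l) = x ⋖ y × CoverChain y l

  CoverChain? : ∀ x l → Dec (CoverChain x l)
  CoverChain? x []      = yes tt
  CoverChain? x (y ∷ l) = (x ⋖? y) ×-dec CoverChain? y l

  lastOf : Fin n → List (Fin n) → Fin n
  lastOf x []      = x
  lastOf x (y ∷ l) = lastOf y l

  -- x ∷ l is a chain x = y₁ ⋖ ⋯ ⋖ yₖ ⋖ 1̂ in P̂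
  UpChain : Fin n → List (Fin n) → Set
  UpChain x l = CoverChain x l × Maximal (lastOf x l)

  UpChain? : ∀ x l → Dec (UpChain x l)
  UpChain? x l = CoverChain? x l ×-dec Maximal? (lastOf x l)

  listsOfLength : ℕ → List (List (Fin n))
  listsOfLength ℕ.zero    = [ [] ]
  listsOfLength (ℕ.suc k) =
    concatMap (λ l → map (λ a → a ∷ l) (allFin n)) (listsOfLength k)

  -- all lists of length < n (a chain in P has at most n elements)
  shortLists : List (List (Fin n))
  shortLists = concatMap listsOfLength (upTo n)

  upChains : Fin n → List (List (Fin n))
  upChains x = filter (UpChain? x) shortLists

  -- all maximal chains of P (chains 0̂ ⋖ y₁ ⋖ ⋯ ⋖ yₖ ⋖ 1̂), as lists y₁ ∷ ⋯ ∷ yₖ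
  maxChains : List (List (Fin n))
  maxChains =
    concatMap (λ x → map (λ l → x ∷ l) (upChains x)) (filter Minimal? (allFin n))

  splitAt : Fin n → List (Fin n) → Maybe (List (Fin n) × List (Fin n))
  splitAt v []      = nothing
  splitAt v (y ∷ l) =
    if does (y ≟ v) then just ([] , y ∷ l)
    else Maybe.map (λ { (pre , post) → (y ∷ pre , post) }) (splitAt v l)

  record LinearExtension : Set where
    field
      ord  : Fin n → Fin n
      inj  : Injective _≡_ _≡_ ord
      surj : StrictlySurjective _≡_ ord
      mono : ∀ i j → ord i < ord j → i Fin.< j

  toList : LinearExtension → List (Fin n)
  toList L = map (LinearExtension.ord L) (allFin n)

module Maps {c ℓ : Level} (S : SkewField c ℓ) (C : SkewField.Carrier S)
            {n : ℕ} (P : FinPoset n) where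
  open SkewField S
  open PosetOps P

  Labeling : Set c
  Labeling = Fin n → Carrier

  sumL : List Carrier → Carrier
  sumL = foldr _+_ 0#

  prodL : List Carrier → Carrier
  prodL = foldr _*_ 1#

  toggleWord : Labeling → List (Fin n) × List (Fin n) → Carrier
  toggleWord g (pre , post) =
    prodL (reverse (map g pre)) * prodL (reverse (map g post))

  toggleSum : Labeling → Fin n → Carrier
  toggleSum g v = sumL (map (toggleWord g) (mapMaybe (splitAt v) maxChains))

  toggle : Fin n → Labeling → Labeling
  toggle v g x = if does (x ≟ v) then C * (toggleSum g v ⁻¹) else g x

  toggles : List (Fin n) → Labeling → Labeling
  toggles []       g = g
  toggles (v ∷ vs) g = toggles vs (toggle v g)

  -- every inverse taken along the way is of a nonzero element
  TogglesDefined : List (Fin n) → Labeling → Set ℓ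
  TogglesDefined []       g = Lift ℓ ⊤
  TogglesDefined (v ∷ vs) g = ¬ (toggleSum g v ≈ 0#) × TogglesDefined vs (toggle v g)

  NAR : LinearExtension → Labeling → Labeling
  NAR L = toggles (toList L)

  NARDefined : LinearExtension → Labeling → Set ℓ
  NARDefined L = TogglesDefined (toList L)

  Δ⁻¹ : Labeling → Labeling
  Δ⁻¹ f x = sumL (map (λ l → prodL (reverse (map f (x ∷ l)))) (upChains x))

  Θ : Labeling → Labeling
  Θ f x = C * (f x ⁻¹)

  -- Σ_{y ⋖ x in P̂} f(y), with f(0̂) = 1
  lowerSum : Labeling → Fin n → Carrier
  lowerSum f x =
    if does (Minimal? x) then 1#
    else sumL (map f (filter (λ y → y ⋖? x) (allFin n)))

  ∇ : Labeling → Labeling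
  ∇ f x = f x * (lowerSum f x ⁻¹)

  RHS : Labeling → Labeling
  RHS g = ∇ (Θ (Δ⁻¹ g))

  RHSDefined : Labeling → Set ℓ
  RHSDefined g = (∀ x → ¬ (Δ⁻¹ g x ≈ 0#))
               × (∀ x → ¬ (lowerSum (Θ (Δ⁻¹ g)) x ≈ 0#))

-- Fix g such that Δ⁻¹ g and the lower sums of Θ (Δ⁻¹ g) are nonzero, and let R = ∇ (Θ (Δ⁻¹ g)).
-- For any labeling h and v ∈ P, the toggle sum at v factorizes as
--     (toggle sum of h at v) = Q_h(v) · (Δ⁻¹ h)(v),
-- where Q_h(v) (called fromBottom below) sums h(y_{c-1}) ⋯ h(y₁) over chains 0̂ ⋖ y₁ ⋖ ⋯ ⋖ y_{c-1} ⋖ v: a maximal chain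
-- through v is cut at v.  Q_h satisfies the recursion Q_h(v) = [v minimal] + Σ_{y ⋖ v} h(y) Q_h(y),
-- so if h already equals R strictly below v, induction downwards gives Q_h(v) = Σ_{y ⋖ v in P̂} Θ(Δ⁻¹g)(y),
-- because R(y) times that lower sum at y is Θ(Δ⁻¹ g)(y).  If moreover h = g weakly above v then
-- (Δ⁻¹ h)(v) = (Δ⁻¹ g)(v), and the toggle at v produces exactly R(v).  Toggling along a linear
-- extension maintains "h = R on toggled elements, h = g on the rest", which proves the theorem.
module Submission where

open import Defs
open import Level using (Level)
open import Algebra.Bundles using (Ring)
open import Data.Bool using (true; false; if_then_else_)
open import Data.Nat as ℕ using (ℕ; zero; suc)
import Data.Nat.Properties as ℕₚ
open import Data.Fin as Fin using (Fin)
open import Data.Fin.Properties using (_≟_; suc-injective; <-irrefl; <-asym)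
open import Data.Fin.Induction using (po-wellFounded; po-noetherian)
open import Data.List using (List; []; _∷_; [_]; _++_; map; foldr; reverse; concatMap; filter; mapMaybe; upTo; applyUpTo; allFin; length)
import Data.List.Properties as Listₚ
open import Data.List.Membership.Propositional using (_∈_; _∉_)
open import Data.List.Membership.Propositional.Properties using (∈-allFin; ∈-map⁺)
open import Data.List.Relation.Unary.Any using (here; there)
import Data.List.Relation.Unary.All as ListAll
open import Data.List.Relation.Unary.AllPairs using (AllPairs; []; _∷_)
import Data.List.Relation.Unary.AllPairs.Properties as AllPairsₚ
open import Data.Maybe using (Maybe; just; nothing; maybe)
open import Data.Product using (_×_; _,_; proj₁; proj₂)
open import Data.Empty using (⊥-elim)
open import Data.Unit using (tt)
open import Function using (id)
import Induction.WellFounded as WF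
open import Relation.Binary using (IsPartialOrder)
open import Relation.Nullary using (¬_; Dec; yes; no; does)
open import Relation.Nullary.Decidable using (dec-true; dec-false)
import Relation.Binary.PropositionalEquality as ≡
open ≡ using (_≡_; _≢_)

-- Guards let sums over filtered index
-- lists be rewritten as sums over a fixed index list, where they can be interchanged.
module RingSums {c ℓ : Level} (R : Ring c ℓ) where
  open Ring R
  open import Relation.Binary.Reasoning.Setoid setoid
  open import Algebra.Properties.CommutativeSemigroup +-commutativeSemigroup using (interchange)

  ∑ : {A : Set} → List A → (A → Carrier) → Carrier
  ∑ xs F = foldr _+_ 0# (map F xs)

  infixr 8 [_]·_
  [_]·_ : {Q : Set} → Dec Q → Carrier → Carrier
  [ d ]· a = if does d then a else 0#

  ∑-cong : ∀ {A : Set} (xs : List A) {F G : A → Carrier} → (∀ x → F x ≈ G x) → ∑ xs F ≈ ∑ xs G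
  ∑-cong []       F≈G = refl
  ∑-cong (x ∷ xs) F≈G = +-cong (F≈G x) (∑-cong xs F≈G)

  ∑-zero : ∀ {A : Set} (xs : List A) {F : A → Carrier} → (∀ x → F x ≈ 0#) → ∑ xs F ≈ 0#
  ∑-zero []       F≈0 = refl
  ∑-zero (x ∷ xs) F≈0 = trans (+-cong (F≈0 x) (∑-zero xs F≈0)) (+-identityˡ 0#)

  ∑-map : ∀ {A B : Set} (f : A → B) (xs : List A) (F : B → Carrier) →
          ∑ (map f xs) F ≡ ∑ xs (λ x → F (f x))
  ∑-map f xs F = ≡.cong (foldr _+_ 0#) (≡.sym (Listₚ.map-∘ xs))

  ∑-++ : ∀ {A : Set} (xs ys : List A) (F : A → Carrier) → ∑ (xs ++ ys) F ≈ ∑ xs F + ∑ ys F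
  ∑-++ []       ys F = sym (+-identityˡ _)
  ∑-++ (x ∷ xs) ys F = trans (+-cong refl (∑-++ xs ys F)) (sym (+-assoc _ _ _))

  ∑-concatMap : ∀ {A B : Set} (f : A → List B) (xs : List A) (F : B → Carrier) →
                ∑ (concatMap f xs) F ≈ ∑ xs (λ x → ∑ (f x) F)
  ∑-concatMap f []       F = refl
  ∑-concatMap f (x ∷ xs) F = trans (∑-++ (f x) (concatMap f xs) F) (+-cong refl (∑-concatMap f xs F))

  ∑-filter : ∀ {A : Set} {Q : A → Set} (Q? : ∀ x → Dec (Q x)) (xs : List A) (F : A → Carrier) →
             ∑ (filter Q? xs) F ≈ ∑ xs (λ x → [ Q? x ]· F x)
  ∑-filter Q? []       F = refl
  ∑-filter Q? (x ∷ xs) F with does (Q? x)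
  ... | true  = +-cong refl (∑-filter Q? xs F)
  ... | false = trans (∑-filter Q? xs F) (sym (+-identityˡ _))

  ∑-mapMaybe : ∀ {A B : Set} (s : A → Maybe B) (xs : List A) (F : B → Carrier) →
               ∑ (mapMaybe s xs) F ≈ ∑ xs (λ x → maybe F 0# (s x))
  ∑-mapMaybe s []       F = refl
  ∑-mapMaybe s (x ∷ xs) F with s x
  ... | just y  = +-cong refl (∑-mapMaybe s xs F)
  ... | nothing = trans (∑-mapMaybe s xs F) (sym (+-identityˡ _))

  ∑-+ : ∀ {A : Set} (xs : List A) (F G : A → Carrier) → ∑ xs (λ x → F x + G x) ≈ ∑ xs F + ∑ xs G
  ∑-+ []       F G = sym (+-identityˡ _)
  ∑-+ (x ∷ xs) F G = trans (+-cong refl (∑-+ xs F G)) (interchange _ _ _ _)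

  ∑-*ˡ : ∀ {A : Set} (a : Carrier) (xs : List A) (F : A → Carrier) → a * ∑ xs F ≈ ∑ xs (λ x → a * F x)
  ∑-*ˡ a []       F = zeroʳ a
  ∑-*ˡ a (x ∷ xs) F = trans (distribˡ _ _ _) (+-cong refl (∑-*ˡ a xs F))

  ∑-*ʳ : ∀ {A : Set} (a : Carrier) (xs : List A) (F : A → Carrier) → ∑ xs F * a ≈ ∑ xs (λ x → F x * a)
  ∑-*ʳ a []       F = zeroˡ a
  ∑-*ʳ a (x ∷ xs) F = trans (distribʳ _ _ _) (+-cong refl (∑-*ʳ a xs F))

  ∑-swap : ∀ {A B : Set} (xs : List A) (ys : List B) (F : A → B → Carrier) →
           ∑ xs (λ x → ∑ ys (F x)) ≈ ∑ ys (λ y → ∑ xs (λ x → F x y))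
  ∑-swap []       ys F = sym (∑-zero ys (λ _ → refl))
  ∑-swap (x ∷ xs) ys F =
    trans (+-cong refl (∑-swap xs ys F)) (sym (∑-+ ys (F x) (λ y → ∑ xs (λ x → F x y))))

  guard-cong : ∀ {Q : Set} (d : Dec Q) {a b : Carrier} → (Q → a ≈ b) → [ d ]· a ≈ [ d ]· b
  guard-cong (yes q) a≈b = a≈b q
  guard-cong (no _)  a≈b = refl

  guard-yes : ∀ {Q : Set} (d : Dec Q) (a : Carrier) → Q → [ d ]· a ≈ a
  guard-yes (yes _)  a q = refl
  guard-yes (no ¬q) a q = ⊥-elim (¬q q)

  guard-no : ∀ {Q : Set} (d : Dec Q) (a : Carrier) → ¬ Q → [ d ]· a ≈ 0#
  guard-no (yes q) a ¬q = ⊥-elim (¬q q)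
  guard-no (no _)  a ¬q = refl

  guard-0 : ∀ {Q : Set} (d : Dec Q) → [ d ]· 0# ≈ 0#
  guard-0 (yes _) = refl
  guard-0 (no _)  = refl

  guard-+ : ∀ {Q : Set} (d : Dec Q) (a b : Carrier) → [ d ]· (a + b) ≈ [ d ]· a + [ d ]· b
  guard-+ (yes _) a b = refl
  guard-+ (no _)  a b = sym (+-identityˡ _)

  guard-*ʳ : ∀ {Q : Set} (d : Dec Q) (a b : Carrier) → ([ d ]· a) * b ≈ [ d ]· (a * b)
  guard-*ʳ (yes _) a b = refl
  guard-*ʳ (no _)  a b = zeroˡ b

  guard-*ˡ : ∀ {Q : Set} (d : Dec Q) (a b : Carrier) → b * ([ d ]· a) ≈ [ d ]· (b * a)
  guard-*ˡ (yes _) a b = refl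
  guard-*ˡ (no _)  a b = zeroʳ b

  guard-∑ : ∀ {Q A : Set} (d : Dec Q) (xs : List A) (F : A → Carrier) →
            [ d ]· ∑ xs F ≈ ∑ xs (λ x → [ d ]· F x)
  guard-∑ (yes _) xs F = refl
  guard-∑ (no _)  xs F = sym (∑-zero xs (λ _ → refl))

  guard-swap : ∀ {Q₁ Q₂ : Set} (d₁ : Dec Q₁) (d₂ : Dec Q₂) (a : Carrier) →
               [ d₁ ]· [ d₂ ]· a ≈ [ d₂ ]· [ d₁ ]· a
  guard-swap (yes _) (yes _) a = refl
  guard-swap (yes _) (no _)  a = refl
  guard-swap (no _)  (yes _) a = refl
  guard-swap (no _)  (no _)  a = refl

  ∑-guarded-swap : ∀ {A B : Set} (xs : List A) (ys : List B) {P : A → Set} {Q : B → Set}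
                   (p : ∀ x → Dec (P x)) (q : ∀ y → Dec (Q y)) (f : B → Carrier) (H : B → A → Carrier) →
                   ∑ xs (λ x → [ p x ]· ∑ ys (λ y → [ q y ]· (f y * H y x)))
                   ≈ ∑ ys (λ y → [ q y ]· (f y * ∑ xs (λ x → [ p x ]· H y x)))
  ∑-guarded-swap xs ys p q f H = begin
      ∑ xs (λ x → [ p x ]· ∑ ys (λ y → [ q y ]· (f y * H y x)))
    ≈⟨ ∑-cong xs (λ x → guard-∑ (p x) ys _) ⟩
      ∑ xs (λ x → ∑ ys (λ y → [ p x ]· [ q y ]· (f y * H y x)))
    ≈⟨ ∑-swap xs ys _ ⟩
      ∑ ys (λ y → ∑ xs (λ x → [ p x ]· [ q y ]· (f y * H y x)))
    ≈⟨ ∑-cong ys (λ y → ∑-cong xs (λ x → trans (guard-swap (p x) (q y) _)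
                                              (guard-cong (q y) (λ _ → sym (guard-*ˡ (p x) _ _))))) ⟩
      ∑ ys (λ y → ∑ xs (λ x → [ q y ]· (f y * [ p x ]· H y x)))
    ≈⟨ ∑-cong ys (λ y → trans (sym (guard-∑ (q y) xs _)) (guard-cong (q y) (λ _ → sym (∑-*ˡ (f y) xs _)))) ⟩
      ∑ ys (λ y → [ q y ]· (f y * ∑ xs (λ x → [ p x ]· H y x))) ∎

  ∑-allFin-suc : ∀ m (G : Fin (suc m) → Carrier) → ∑ (allFin (suc m)) G ≡ G Fin.zero + ∑ (allFin m) (λ i → G (Fin.suc i))
  ∑-allFin-suc m G = ≡.cong (λ l → G Fin.zero + foldr _+_ 0# l)
    (≡.trans (Listₚ.map-tabulate Fin.suc G) (≡.sym (Listₚ.map-tabulate id (λ i → G (Fin.suc i)))))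

  ∑-single : ∀ {m} {Q : Fin m → Set} (Q? : ∀ a → Dec (Q a)) (v : Fin m) → Q v → (∀ a → Q a → a ≡ v) →
             (F : Fin m → Carrier) → ∑ (allFin m) (λ a → [ Q? a ]· F a) ≈ F v
  ∑-single {suc m} Q? Fin.zero qv only F = begin
      ∑ (allFin (suc m)) (λ a → [ Q? a ]· F a)
    ≡⟨ ∑-allFin-suc m _ ⟩
      [ Q? Fin.zero ]· F Fin.zero + ∑ (allFin m) (λ a → [ Q? (Fin.suc a) ]· F (Fin.suc a))
    ≈⟨ +-cong (guard-yes (Q? Fin.zero) _ qv) (∑-zero (allFin m) (λ a → guard-no (Q? (Fin.suc a)) _ (λ q → suc≢zero (only _ q)))) ⟩
      F Fin.zero + 0#
    ≈⟨ +-identityʳ _ ⟩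
      F Fin.zero ∎
    where
    suc≢zero : ∀ {a : Fin m} → Fin.suc a ≢ Fin.zero
    suc≢zero ()
  ∑-single {suc m} Q? (Fin.suc v) qv only F = begin
      ∑ (allFin (suc m)) (λ a → [ Q? a ]· F a)
    ≡⟨ ∑-allFin-suc m _ ⟩
      [ Q? Fin.zero ]· F Fin.zero + ∑ (allFin m) (λ a → [ Q? (Fin.suc a) ]· F (Fin.suc a))
    ≈⟨ +-cong (guard-no (Q? Fin.zero) _ (λ q → zero≢suc (only _ q))) refl ⟩
      0# + ∑ (allFin m) (λ a → [ Q? (Fin.suc a) ]· F (Fin.suc a))
    ≈⟨ +-identityˡ _ ⟩
      ∑ (allFin m) (λ a → [ Q? (Fin.suc a) ]· F (Fin.suc a))
    ≈⟨ ∑-single (λ a → Q? (Fin.suc a)) v qv (λ a q → suc-injective (only _ q)) (λ a → F (Fin.suc a)) ⟩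
      F (Fin.suc v) ∎
    where
    zero≢suc : Fin.zero ≢ Fin.suc v
    zero≢suc ()

module SkewFieldInverse {c ℓ : Level} (S : SkewField c ℓ) where
  open SkewField S
  open import Relation.Binary.Reasoning.Setoid setoid

  ⁻¹-unique : ∀ a b → ¬ (a ≈ 0#) → a * b ≈ 1# → a ⁻¹ ≈ b
  ⁻¹-unique a b a≉0 ab≈1 = begin
      a ⁻¹               ≈⟨ sym (*-identityʳ _) ⟩
      a ⁻¹ * 1#          ≈⟨ *-cong refl (sym ab≈1) ⟩
      a ⁻¹ * (a * b)     ≈⟨ sym (*-assoc _ _ _) ⟩
      (a ⁻¹ * a) * b     ≈⟨ *-cong (⁻¹-inverseˡ a a≉0) refl ⟩
      1# * b             ≈⟨ *-identityˡ b ⟩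
      b                  ∎

  *-nonzero : ∀ a b → ¬ (a ≈ 0#) → ¬ (b ≈ 0#) → ¬ (a * b ≈ 0#)
  *-nonzero a b a≉0 b≉0 ab≈0 = a≉0 (begin
      a                  ≈⟨ sym (*-identityʳ _) ⟩
      a * 1#             ≈⟨ *-cong refl (sym (⁻¹-inverseʳ b b≉0)) ⟩
      a * (b * b ⁻¹)     ≈⟨ sym (*-assoc _ _ _) ⟩
      (a * b) * b ⁻¹     ≈⟨ *-cong ab≈0 refl ⟩
      0# * b ⁻¹          ≈⟨ zeroˡ _ ⟩
      0#                 ∎)

  ⁻¹-anti-* : ∀ a b → ¬ (a ≈ 0#) → ¬ (b ≈ 0#) → (a * b) ⁻¹ ≈ b ⁻¹ * a ⁻¹
  ⁻¹-anti-* a b a≉0 b≉0 = ⁻¹-unique (a * b) (b ⁻¹ * a ⁻¹) (*-nonzero a b a≉0 b≉0) (begin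
      (a * b) * (b ⁻¹ * a ⁻¹)   ≈⟨ *-assoc _ _ _ ⟩
      a * (b * (b ⁻¹ * a ⁻¹))   ≈⟨ *-cong refl (sym (*-assoc _ _ _)) ⟩
      a * ((b * b ⁻¹) * a ⁻¹)   ≈⟨ *-cong refl (*-cong (⁻¹-inverseʳ b b≉0) refl) ⟩
      a * (1# * a ⁻¹)           ≈⟨ *-cong refl (*-identityˡ _) ⟩
      a * a ⁻¹                  ≈⟨ ⁻¹-inverseʳ a a≉0 ⟩
      1#                        ∎)

module PosetFacts {n : ℕ} (P : FinPoset n) where
  open FinPoset P
  open PosetOps P
  module ≤ = IsPartialOrder isPartialOrder

  <-trans : ∀ {x y z} → x < y → y < z → x < z
  <-trans (x≤y , x≢y) (y≤z , y≢z) =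
    ≤.trans x≤y y≤z , λ { ≡.refl → y≢z (≤.antisym y≤z x≤y) }

  <⇒≱ : ∀ {x y} → x < y → ¬ (y ≤ x)
  <⇒≱ (x≤y , x≢y) y≤x = x≢y (≤.antisym x≤y y≤x)

  ⋖⇒< : ∀ {x y} → x ⋖ y → x < y
  ⋖⇒< = proj₁

  ↑-induction : ∀ {q} (Q : Fin n → Set q) → (∀ x → (∀ {a} → x < a → Q a) → Q x) → ∀ x → Q x
  ↑-induction {q} = WF.All.wfRec (po-noetherian isPartialOrder) q

  ↓-induction : ∀ {q} (Q : Fin n → Set q) → (∀ x → (∀ {a} → a < x → Q a) → Q x) → ∀ x → Q x
  ↓-induction {q} = WF.All.wfRec (po-wellFounded isPartialOrder) q

  count : {A : Set} {Q : A → Set} → (∀ z → Dec (Q z)) → List A → ℕ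
  count Q? []       = 0
  count Q? (x ∷ xs) = if does (Q? x) then suc (count Q? xs) else count Q? xs

  count-mono : ∀ {A : Set} {Q₁ Q₂ : A → Set} (Q₁? : ∀ z → Dec (Q₁ z)) (Q₂? : ∀ z → Dec (Q₂ z)) →
               (∀ z → Q₁ z → Q₂ z) → ∀ xs → count Q₁? xs ℕ.≤ count Q₂? xs
  count-mono Q₁? Q₂? Q₁⇒Q₂ [] = ℕ.z≤n
  count-mono Q₁? Q₂? Q₁⇒Q₂ (x ∷ xs) with Q₁? x | Q₂? x
  ... | yes _  | yes _  = ℕ.s≤s (count-mono Q₁? Q₂? Q₁⇒Q₂ xs)
  ... | yes q₁ | no ¬q₂ = ⊥-elim (¬q₂ (Q₁⇒Q₂ x q₁))
  ... | no _   | yes _  = ℕₚ.m≤n⇒m≤1+n (count-mono Q₁? Q₂? Q₁⇒Q₂ xs)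
  ... | no _   | no _   = count-mono Q₁? Q₂? Q₁⇒Q₂ xs

  count-strict : ∀ {A : Set} {Q₁ Q₂ : A → Set} (Q₁? : ∀ z → Dec (Q₁ z)) (Q₂? : ∀ z → Dec (Q₂ z)) →
                 (∀ z → Q₁ z → Q₂ z) → ∀ {w} xs → w ∈ xs → Q₂ w → ¬ Q₁ w → count Q₁? xs ℕ.< count Q₂? xs
  count-strict Q₁? Q₂? Q₁⇒Q₂ (x ∷ xs) (here ≡.refl) q₂ ¬q₁ with Q₁? x | Q₂? x
  ... | yes q₁ | _      = ⊥-elim (¬q₁ q₁)
  ... | no _   | yes _  = ℕ.s≤s (count-mono Q₁? Q₂? Q₁⇒Q₂ xs)
  ... | no _   | no ¬q₂ = ⊥-elim (¬q₂ q₂)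
  count-strict Q₁? Q₂? Q₁⇒Q₂ (x ∷ xs) (there w∈xs) q₂ ¬q₁ with Q₁? x | Q₂? x
  ... | yes _  | yes _  = ℕ.s≤s (count-strict Q₁? Q₂? Q₁⇒Q₂ xs w∈xs q₂ ¬q₁)
  ... | yes q₁ | no ¬q₂ = ⊥-elim (¬q₂ (Q₁⇒Q₂ x q₁))
  ... | no _   | yes _  = ℕₚ.m≤n⇒m≤1+n (count-strict Q₁? Q₂? Q₁⇒Q₂ xs w∈xs q₂ ¬q₁)
  ... | no _   | no _   = count-strict Q₁? Q₂? Q₁⇒Q₂ xs w∈xs q₂ ¬q₁

  count-all : ∀ {A : Set} (xs : List A) → count (λ _ → yes tt) xs ≡ length xs
  count-all []       = ≡.refl
  count-all (x ∷ xs) = ≡.cong suc (count-all xs)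

  height : Fin n → ℕ
  height x = count (x <?_) (allFin n)

  height-< : ∀ {x a} → x < a → height a ℕ.< height x
  height-< {x} {a} x<a =
    count-strict (a <?_) (x <?_) (λ z a<z → <-trans x<a a<z) (allFin n) (∈-allFin a) x<a (λ a<a → proj₂ a<a ≡.refl)

  height<n : ∀ x → height x ℕ.< n
  height<n x = ℕₚ.<-≤-trans
    (count-strict (x <?_) (λ _ → yes tt) _ (allFin n) (∈-allFin x) tt (λ x<x → proj₂ x<x ≡.refl))
    (ℕₚ.≤-reflexive (≡.trans (count-all (allFin n)) (Listₚ.length-tabulate id)))

-- The enumeration runs over lists of length < n, so the
-- recursion is first proved for truncated sums, which stabilise once the bound exceeds the height.
module UpChainSums {c ℓ : Level} (R : Ring c ℓ) {n : ℕ} (P : FinPoset n) where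
  open Ring R
  open PosetOps P
  open PosetFacts P
  open RingSums R
  open import Relation.Binary.Reasoning.Setoid setoid

  ∑-short : ℕ → (List (Fin n) → Carrier) → Carrier
  ∑-short N F = ∑ (concatMap listsOfLength (upTo N)) F

  ∑-ofLength-suc : ∀ k F → ∑ (listsOfLength (suc k)) F ≈ ∑ (allFin n) (λ a → ∑ (listsOfLength k) (λ l → F (a ∷ l)))
  ∑-ofLength-suc k F = begin
      ∑ (listsOfLength (suc k)) F
    ≈⟨ ∑-concatMap (λ l → map (_∷ l) (allFin n)) (listsOfLength k) F ⟩
      ∑ (listsOfLength k) (λ l → ∑ (map (_∷ l) (allFin n)) F)
    ≡⟨ ≡.cong (foldr _+_ 0#) (Listₚ.map-cong (λ l → ∑-map (_∷ l) (allFin n) F) (listsOfLength k)) ⟩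
      ∑ (listsOfLength k) (λ l → ∑ (allFin n) (λ a → F (a ∷ l)))
    ≈⟨ ∑-swap (listsOfLength k) (allFin n) (λ l a → F (a ∷ l)) ⟩
      ∑ (allFin n) (λ a → ∑ (listsOfLength k) (λ l → F (a ∷ l))) ∎

  ∑-short-suc : ∀ N F → ∑-short (suc N) F ≈ F [] + ∑ (allFin n) (λ a → ∑-short N (λ l → F (a ∷ l)))
  ∑-short-suc N F = +-cong refl (begin
      ∑ (concatMap listsOfLength (applyUpTo suc N)) F
    ≈⟨ ∑-concatMap listsOfLength (applyUpTo suc N) F ⟩
      ∑ (applyUpTo suc N) (λ k → ∑ (listsOfLength k) F)
    ≡⟨ ≡.trans (≡.cong (λ ks → ∑ ks (λ k → ∑ (listsOfLength k) F)) (≡.sym (Listₚ.map-applyUpTo id suc N)))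
               (∑-map suc (upTo N) (λ k → ∑ (listsOfLength k) F)) ⟩
      ∑ (upTo N) (λ k → ∑ (listsOfLength (suc k)) F)
    ≈⟨ ∑-cong (upTo N) (λ k → ∑-ofLength-suc k F) ⟩
      ∑ (upTo N) (λ k → ∑ (allFin n) (λ a → ∑ (listsOfLength k) (λ l → F (a ∷ l))))
    ≈⟨ ∑-swap (upTo N) (allFin n) _ ⟩
      ∑ (allFin n) (λ a → ∑ (upTo N) (λ k → ∑ (listsOfLength k) (λ l → F (a ∷ l))))
    ≈⟨ ∑-cong (allFin n) (λ a → sym (∑-concatMap listsOfLength (upTo N) _)) ⟩
      ∑ (allFin n) (λ a → ∑-short N (λ l → F (a ∷ l))) ∎)

  upSum≤ : ℕ → Fin n → (List (Fin n) → Carrier) → Carrier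
  upSum≤ N x F = ∑-short N (λ l → [ UpChain? x l ]· F (x ∷ l))

  upSum : Fin n → (List (Fin n) → Carrier) → Carrier
  upSum x F = ∑ (upChains x) (λ l → F (x ∷ l))

  upSum-truncated : ∀ x F → upSum x F ≈ upSum≤ n x F
  upSum-truncated x F = ∑-filter (UpChain? x) shortLists (λ l → F (x ∷ l))

  guard-UpChain-cons : ∀ x a l t → [ UpChain? x (a ∷ l) ]· t ≡ [ x ⋖? a ]· [ UpChain? a l ]· t
  guard-UpChain-cons x a l t with does (x ⋖? a)
  ... | true  = ≡.refl
  ... | false = ≡.refl

  upSum≤-suc : ∀ N x F → upSum≤ (suc N) x F
               ≈ [ Maximal? x ]· F [ x ] + ∑ (allFin n) (λ a → [ x ⋖? a ]· upSum≤ N a (λ m → F (x ∷ m)))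
  upSum≤-suc N x F = trans (∑-short-suc N _) (+-cong refl (∑-cong (allFin n) (λ a → begin
      ∑-short N (λ l → [ UpChain? x (a ∷ l) ]· F (x ∷ a ∷ l))
    ≡⟨ ≡.cong (foldr _+_ 0#) (Listₚ.map-cong (λ l → guard-UpChain-cons x a l _) (concatMap listsOfLength (upTo N))) ⟩
      ∑-short N (λ l → [ x ⋖? a ]· [ UpChain? a l ]· F (x ∷ a ∷ l))
    ≈⟨ sym (guard-∑ (x ⋖? a) (concatMap listsOfLength (upTo N)) _) ⟩
      [ x ⋖? a ]· upSum≤ N a (λ m → F (x ∷ m)) ∎)))

  upSum≤-stable : ∀ N x F → height x ℕ.< N → upSum≤ (suc N) x F ≈ upSum≤ N x F
  upSum≤-stable (suc N) x F h<N = begin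
      upSum≤ (suc (suc N)) x F
    ≈⟨ upSum≤-suc (suc N) x F ⟩
      [ Maximal? x ]· F [ x ] + ∑ (allFin n) (λ a → [ x ⋖? a ]· upSum≤ (suc N) a (λ m → F (x ∷ m)))
    ≈⟨ +-cong refl (∑-cong (allFin n) (λ a → guard-cong (x ⋖? a) (λ x⋖a →
         upSum≤-stable N a (λ m → F (x ∷ m)) (ℕₚ.<-≤-trans (height-< (⋖⇒< x⋖a)) (ℕₚ.≤-pred h<N))))) ⟩
      [ Maximal? x ]· F [ x ] + ∑ (allFin n) (λ a → [ x ⋖? a ]· upSum≤ N a (λ m → F (x ∷ m)))
    ≈⟨ sym (upSum≤-suc N x F) ⟩
      upSum≤ (suc N) x F ∎

  upSum-rec : ∀ x F → upSum x F
              ≈ [ Maximal? x ]· F [ x ] + ∑ (allFin n) (λ a → [ x ⋖? a ]· upSum a (λ m → F (x ∷ m)))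
  upSum-rec x F = begin
      upSum x F
    ≈⟨ upSum-truncated x F ⟩
      upSum≤ n x F
    ≈⟨ sym (upSum≤-stable n x F (height<n x)) ⟩
      upSum≤ (suc n) x F
    ≈⟨ upSum≤-suc n x F ⟩
      [ Maximal? x ]· F [ x ] + ∑ (allFin n) (λ a → [ x ⋖? a ]· upSum≤ n a (λ m → F (x ∷ m)))
    ≈⟨ +-cong refl (∑-cong (allFin n) (λ a → guard-cong (x ⋖? a) (λ _ → sym (upSum-truncated a (λ m → F (x ∷ m)))))) ⟩
      [ Maximal? x ]· F [ x ] + ∑ (allFin n) (λ a → [ x ⋖? a ]· upSum a (λ m → F (x ∷ m))) ∎

  upSum-cong : ∀ x (F G : List (Fin n) → Carrier) → (∀ l → UpChain x l → F (x ∷ l) ≈ G (x ∷ l)) →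
               upSum x F ≈ upSum x G
  upSum-cong x F G F≈G = begin
      upSum x F     ≈⟨ upSum-truncated x F ⟩
      upSum≤ n x F  ≈⟨ ∑-cong shortLists (λ l → guard-cong (UpChain? x l) (F≈G l)) ⟩
      upSum≤ n x G  ≈⟨ sym (upSum-truncated x G) ⟩
      upSum x G     ∎

  upSum-*ˡ : ∀ x a F → upSum x (λ m → a * F m) ≈ a * upSum x F
  upSum-*ˡ x a F = sym (∑-*ˡ a (upChains x) (λ l → F (x ∷ l)))

-- Path sums for a labeling h: pathSum x v sums h(y_{c-1}) ⋯ h(y₁) over the chains
-- x = y₁ ⋖ ⋯ ⋖ y_{c-1} ⋖ y_c = v (the empty product 1 when x = v).  They are defined by the
-- first-step recursion, with fuel n exceeding every height, and satisfy the last-step recursion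
-- too.
module PathSums {c ℓ : Level} (R : Ring c ℓ) {n : ℕ} (P : FinPoset n) (h : Fin n → Ring.Carrier R) where
  open Ring R
  open FinPoset P
  open PosetOps P
  open PosetFacts P
  open RingSums R
  open UpChainSums R P
  open import Relation.Binary.Reasoning.Setoid setoid

  ∑ᴾ : (Fin n → Carrier) → Carrier
  ∑ᴾ = ∑ (allFin n)

  δ : Fin n → Fin n → Carrier
  δ x y = [ x ≟ y ]· 1#

  δ-*ˡ : ∀ x y t → δ x y * t ≈ [ x ≟ y ]· t
  δ-*ˡ x y t = trans (guard-*ʳ (x ≟ y) 1# t) (guard-cong (x ≟ y) (λ _ → *-identityˡ t))

  δ-*ʳ : ∀ x y t → t * δ x y ≈ [ x ≟ y ]· t
  δ-*ʳ x y t = trans (guard-*ˡ (x ≟ y) 1# t) (guard-cong (x ≟ y) (λ _ → *-identityʳ t))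

  ∑-at : ∀ v (F : Fin n → Carrier) → ∑ᴾ (λ a → [ a ≟ v ]· F a) ≈ F v
  ∑-at v = ∑-single (_≟ v) v ≡.refl (λ _ a≡v → a≡v)

  ∑-at′ : ∀ x (F : Fin n → Carrier) → ∑ᴾ (λ y → [ x ≟ y ]· F y) ≈ F x
  ∑-at′ x = ∑-single (x ≟_) x ≡.refl (λ _ x≡y → ≡.sym x≡y)

  pathSum≤ : ℕ → Fin n → Fin n → Carrier
  pathSum≤ zero    x v = δ x v
  pathSum≤ (suc N) x v = if does (x ≟ v) then 1# else ∑ᴾ (λ a → [ x ⋖? a ]· (pathSum≤ N a v * h x))

  -- fuel beyond the height of x changes nothing, as paths from x have fewer steps
  pathSum≤-stable : ∀ N x v → height x ℕ.< N → pathSum≤ (suc N) x v ≈ pathSum≤ N x v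
  pathSum≤-stable (suc N) x v h<N with x ≟ v
  ... | yes _ = refl
  ... | no _  = ∑-cong (allFin n) (λ a → guard-cong (x ⋖? a) (λ x⋖a →
                  *-cong (pathSum≤-stable N a v (ℕₚ.<-≤-trans (height-< (⋖⇒< x⋖a)) (ℕₚ.≤-pred h<N))) refl))

  pathSum : Fin n → Fin n → Carrier
  pathSum = pathSum≤ n

  pathSum-refl : ∀ x → pathSum x x ≈ 1#
  pathSum-refl x = trans (sym (pathSum≤-stable n x x (height<n x))) diagonal
    where
    diagonal : pathSum≤ (suc n) x x ≈ 1#
    diagonal with x ≟ x
    ... | yes _   = refl
    ... | no x≢x = ⊥-elim (x≢x ≡.refl)

  pathSum-step : ∀ x v → x ≢ v → pathSum x v ≈ ∑ᴾ (λ a → [ x ⋖? a ]· (pathSum a v * h x))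
  pathSum-step x v x≢v = trans (sym (pathSum≤-stable n x v (height<n x))) unfold
    where
    unfold : pathSum≤ (suc n) x v ≈ ∑ᴾ (λ a → [ x ⋖? a ]· (pathSum a v * h x))
    unfold with x ≟ v
    ... | yes x≡v = ⊥-elim (x≢v x≡v)
    ... | no _    = refl

  pathSum-≰ : ∀ x v → ¬ (x ≤ v) → pathSum x v ≈ 0#
  pathSum-≰ = ↑-induction (λ x → ∀ v → ¬ (x ≤ v) → pathSum x v ≈ 0#) λ x ih v x≰v →
    trans (pathSum-step x v (λ { ≡.refl → x≰v ≤.refl }))
          (∑-zero (allFin n) (λ a → trans (guard-cong (x ⋖? a) (λ x⋖a →
            trans (*-cong (ih (⋖⇒< x⋖a) v (λ a≤v → x≰v (≤.trans (proj₁ (⋖⇒< x⋖a)) a≤v))) refl) (zeroˡ _)))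
            (guard-0 (x ⋖? a))))

  pathSum-first : ∀ x v → pathSum x v ≈ δ x v + ∑ᴾ (λ a → [ x ⋖? a ]· (pathSum a v * h x))
  pathSum-first x v with x ≟ v
  ... | yes ≡.refl = trans (pathSum-refl x) (sym (trans (+-cong refl (∑-zero (allFin n) (λ a →
          trans (guard-cong (x ⋖? a) (λ x⋖a → trans (*-cong (pathSum-≰ a x (<⇒≱ (⋖⇒< x⋖a))) refl) (zeroˡ _)))
                (guard-0 (x ⋖? a))))) (+-identityʳ _)))
  ... | no x≢v = trans (pathSum-step x v x≢v) (sym (+-identityˡ _))

  pathSum-last : ∀ x v → pathSum x v ≈ δ x v + ∑ᴾ (λ y → [ y ⋖? v ]· (h y * pathSum x y))
  pathSum-last = ↑-induction (λ x → ∀ v → pathSum x v ≈ δ x v + ∑ᴾ (λ y → [ y ⋖? v ]· (h y * pathSum x y))) step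
    where
    step : ∀ x → (∀ {a} → x < a → ∀ v → pathSum a v ≈ δ a v + ∑ᴾ (λ y → [ y ⋖? v ]· (h y * pathSum a y))) →
           ∀ v → pathSum x v ≈ δ x v + ∑ᴾ (λ y → [ y ⋖? v ]· (h y * pathSum x y))
    step x ih v with x ≟ v
    ... | yes ≡.refl = trans (pathSum-refl x) (sym (trans (+-cong refl (∑-zero (allFin n) (λ y →
            trans (guard-cong (y ⋖? x) (λ y⋖x → trans (*-cong refl (pathSum-≰ x y (<⇒≱ (⋖⇒< y⋖x)))) (zeroʳ _)))
                  (guard-0 (y ⋖? x))))) (+-identityʳ _)))
    ... | no x≢v = begin
        pathSum x v
      ≈⟨ pathSum-step x v x≢v ⟩
        ∑ᴾ (λ a → [ x ⋖? a ]· (pathSum a v * h x))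
      ≈⟨ ∑-cong (allFin n) (λ a → guard-cong (x ⋖? a) (λ x⋖a → *-cong (ih (⋖⇒< x⋖a) v) refl)) ⟩
        ∑ᴾ (λ a → [ x ⋖? a ]· ((δ a v + lastSteps a) * h x))
      ≈⟨ ∑-cong (allFin n) (λ a → trans (guard-cong (x ⋖? a) (λ _ → distribʳ _ _ _)) (guard-+ (x ⋖? a) _ _)) ⟩
        ∑ᴾ (λ a → [ x ⋖? a ]· (δ a v * h x) + [ x ⋖? a ]· (lastSteps a * h x))
      ≈⟨ ∑-+ (allFin n) _ _ ⟩
        ∑ᴾ (λ a → [ x ⋖? a ]· (δ a v * h x)) + ∑ᴾ (λ a → [ x ⋖? a ]· (lastSteps a * h x))
      ≈⟨ +-cong oneStep twoSteps ⟩
        ∑ᴾ (λ y → [ y ⋖? v ]· (h y * δ x y)) + ∑ᴾ (λ y → [ y ⋖? v ]· (h y * firstSteps y))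
      ≈⟨ sym (∑-+ (allFin n) _ _) ⟩
        ∑ᴾ (λ y → [ y ⋖? v ]· (h y * δ x y) + [ y ⋖? v ]· (h y * firstSteps y))
      ≈⟨ ∑-cong (allFin n) (λ y → trans (sym (guard-+ (y ⋖? v) _ _)) (guard-cong (y ⋖? v) (λ _ →
           trans (sym (distribˡ _ _ _)) (*-cong refl (sym (pathSum-first x y)))))) ⟩
        ∑ᴾ (λ y → [ y ⋖? v ]· (h y * pathSum x y))
      ≈⟨ sym (+-identityˡ _) ⟩
        0# + ∑ᴾ (λ y → [ y ⋖? v ]· (h y * pathSum x y)) ∎
      where
      lastSteps : Fin n → Carrier
      lastSteps a = ∑ᴾ (λ y → [ y ⋖? v ]· (h y * pathSum a y))
      firstSteps : Fin n → Carrier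
      firstSteps y = ∑ᴾ (λ a → [ x ⋖? a ]· (pathSum a y * h x))
      -- the one-step path x ⋖ v, seen from either end
      oneStep : ∑ᴾ (λ a → [ x ⋖? a ]· (δ a v * h x)) ≈ ∑ᴾ (λ y → [ y ⋖? v ]· (h y * δ x y))
      oneStep = begin
          ∑ᴾ (λ a → [ x ⋖? a ]· (δ a v * h x))
        ≈⟨ ∑-cong (allFin n) (λ a → trans (guard-cong (x ⋖? a) (λ _ → δ-*ˡ a v (h x))) (guard-swap (x ⋖? a) (a ≟ v) _)) ⟩
          ∑ᴾ (λ a → [ a ≟ v ]· [ x ⋖? a ]· h x)
        ≈⟨ ∑-at v (λ a → [ x ⋖? a ]· h x) ⟩
          [ x ⋖? v ]· h x
        ≈⟨ sym (∑-at′ x (λ y → [ y ⋖? v ]· h y)) ⟩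
          ∑ᴾ (λ y → [ x ≟ y ]· [ y ⋖? v ]· h y)
        ≈⟨ ∑-cong (allFin n) (λ y → trans (guard-swap (x ≟ y) (y ⋖? v) _) (guard-cong (y ⋖? v) (λ _ → sym (δ-*ʳ x y (h y))))) ⟩
          ∑ᴾ (λ y → [ y ⋖? v ]· (h y * δ x y)) ∎
      -- longer paths x ⋖ a ⋯ y ⋖ v, with the inner sums interchanged
      twoSteps : ∑ᴾ (λ a → [ x ⋖? a ]· (lastSteps a * h x)) ≈ ∑ᴾ (λ y → [ y ⋖? v ]· (h y * firstSteps y))
      twoSteps = begin
          ∑ᴾ (λ a → [ x ⋖? a ]· (lastSteps a * h x))
        ≈⟨ ∑-cong (allFin n) (λ a → guard-cong (x ⋖? a) (λ _ → trans (∑-*ʳ (h x) (allFin n) _)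
             (∑-cong (allFin n) (λ y → trans (guard-*ʳ (y ⋖? v) _ _) (guard-cong (y ⋖? v) (λ _ → *-assoc _ _ _)))))) ⟩
          ∑ᴾ (λ a → [ x ⋖? a ]· ∑ᴾ (λ y → [ y ⋖? v ]· (h y * (pathSum a y * h x))))
        ≈⟨ ∑-guarded-swap (allFin n) (allFin n) (x ⋖?_) (_⋖? v) h (λ y a → pathSum a y * h x) ⟩
          ∑ᴾ (λ y → [ y ⋖? v ]· (h y * firstSteps y)) ∎

  -- the sum of h(y_{c-1}) ⋯ h(y₁) over chains 0̂ ⋖ y₁ ⋖ ⋯ ⋖ y_{c-1} ⋖ v in P̂
  fromBottom : Fin n → Carrier
  fromBottom v = ∑ᴾ (λ x → [ Minimal? x ]· pathSum x v)

  fromBottom-rec : ∀ v → fromBottom v ≈ [ Minimal? v ]· 1# + ∑ᴾ (λ y → [ y ⋖? v ]· (h y * fromBottom y))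
  fromBottom-rec v = begin
      fromBottom v
    ≈⟨ ∑-cong (allFin n) (λ x → trans (guard-cong (Minimal? x) (λ _ → pathSum-last x v)) (guard-+ (Minimal? x) _ _)) ⟩
      ∑ᴾ (λ x → [ Minimal? x ]· δ x v + [ Minimal? x ]· ∑ᴾ (λ y → [ y ⋖? v ]· (h y * pathSum x y)))
    ≈⟨ ∑-+ (allFin n) _ _ ⟩
      ∑ᴾ (λ x → [ Minimal? x ]· δ x v) + ∑ᴾ (λ x → [ Minimal? x ]· ∑ᴾ (λ y → [ y ⋖? v ]· (h y * pathSum x y)))
    ≈⟨ +-cong (trans (∑-cong (allFin n) (λ x → guard-swap (Minimal? x) (x ≟ v) 1#)) (∑-at v (λ x → [ Minimal? x ]· 1#)))
              (∑-guarded-swap (allFin n) (allFin n) Minimal? (_⋖? v) h (λ y x → pathSum x y)) ⟩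
      [ Minimal? v ]· 1# + ∑ᴾ (λ y → [ y ⋖? v ]· (h y * fromBottom y)) ∎

  weight : List (Fin n) → Carrier
  weight l = foldr _*_ 1# (reverse (map h l))

  product-++ : ∀ as bs → foldr _*_ 1# (as ++ bs) ≈ foldr _*_ 1# as * foldr _*_ 1# bs
  product-++ []       bs = sym (*-identityˡ _)
  product-++ (a ∷ as) bs = trans (*-cong refl (product-++ as bs)) (sym (*-assoc _ _ _))

  weight-cons : ∀ x l → weight (x ∷ l) ≈ weight l * h x
  weight-cons x l = trans (reflexive (≡.cong (foldr _*_ 1#) (Listₚ.unfold-reverse (h x) (map h l))))
                          (trans (product-++ (reverse (map h l)) [ h x ]) (*-cong refl (*-identityʳ _)))

  splitWord : Carrier → List (Fin n) × List (Fin n) → Carrier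
  splitWord c (pre , post) = weight pre * (c * weight post)

  cut : Carrier → Fin n → List (Fin n) → Carrier
  cut c v m = maybe (splitWord c) 0# (splitAt v m)

  splitWord-here : ∀ x l c → cut c x (x ∷ l) ≈ c * weight (x ∷ l)
  splitWord-here x l c with x ≟ x
  ... | yes _   = *-identityˡ _
  ... | no x≢x = ⊥-elim (x≢x ≡.refl)

  splitWord-skip : ∀ v x m c → x ≢ v →
                   cut c v (x ∷ m) ≈ cut (h x * c) v m
  splitWord-skip v x m c x≢v with x ≟ v
  ... | yes x≡v = ⊥-elim (x≢v x≡v)
  ... | no _ with splitAt v m
  ...   | nothing          = refl
  ...   | just (pre , post) =
          trans (*-cong (weight-cons x pre) refl) (trans (*-assoc _ _ _) (*-cong refl (sym (*-assoc _ _ _))))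

  -- cutting every up-chain from x at v: chains avoiding v contribute nothing, and the others
  -- factor as a path from x to v followed by an up-chain from v
  upSum-split : ∀ v x c → upSum x (cut c v) ≈ pathSum x v * (c * upSum v weight)
  upSum-split v = ↑-induction (λ x → ∀ c → upSum x (cut c v) ≈ pathSum x v * (c * upSum v weight)) step
    where
    step : ∀ x → (∀ {a} → x < a → ∀ c → upSum a (cut c v) ≈ pathSum a v * (c * upSum v weight)) →
           ∀ c → upSum x (cut c v) ≈ pathSum x v * (c * upSum v weight)
    step x ih c = byCases (x ≟ v)
      where
      byCases : Dec (x ≡ v) → upSum x (cut c v) ≈ pathSum x v * (c * upSum v weight)
      byCases (yes ≡.refl) = begin
          upSum x (cut c x)
        ≈⟨ upSum-cong x (cut c x) (λ m → c * weight m) (λ l _ → splitWord-here x l c) ⟩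
          upSum x (λ m → c * weight m)
        ≈⟨ upSum-*ˡ x c weight ⟩
          c * upSum x weight
        ≈⟨ sym (trans (*-cong (pathSum-refl x) refl) (*-identityˡ _)) ⟩
          pathSum x x * (c * upSum x weight) ∎
      byCases (no x≢v) = begin
          upSum x (cut c v)
        ≈⟨ upSum-rec x (cut c v) ⟩
          [ Maximal? x ]· cut c v [ x ]
            + ∑ᴾ (λ a → [ x ⋖? a ]· upSum a (λ m → cut c v (x ∷ m)))
        ≈⟨ +-cong (trans (guard-cong (Maximal? x) (λ _ → splitWord-skip v x [] c x≢v)) (guard-0 (Maximal? x)))
                  (∑-cong (allFin n) (λ a → guard-cong (x ⋖? a) (λ x⋖a →
                    trans (upSum-cong a (λ m → cut c v (x ∷ m)) (cut (h x * c) v) (λ l _ → splitWord-skip v x (a ∷ l) c x≢v)) (ih (⋖⇒< x⋖a) (h x * c))))) ⟩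
          0# + ∑ᴾ (λ a → [ x ⋖? a ]· (pathSum a v * ((h x * c) * upSum v weight)))
        ≈⟨ +-identityˡ _ ⟩
          ∑ᴾ (λ a → [ x ⋖? a ]· (pathSum a v * ((h x * c) * upSum v weight)))
        ≈⟨ ∑-cong (allFin n) (λ a → trans (guard-cong (x ⋖? a) (λ _ → trans (*-cong refl (*-assoc _ _ _)) (sym (*-assoc _ _ _))))
                                          (sym (guard-*ʳ (x ⋖? a) _ _))) ⟩
          ∑ᴾ (λ a → ([ x ⋖? a ]· (pathSum a v * h x)) * (c * upSum v weight))
        ≈⟨ sym (∑-*ʳ _ (allFin n) _) ⟩
          ∑ᴾ (λ a → [ x ⋖? a ]· (pathSum a v * h x)) * (c * upSum v weight)
        ≈⟨ *-cong (sym (pathSum-step x v x≢v)) refl ⟩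
          pathSum x v * (c * upSum v weight) ∎

module Rowmotion {c ℓ : Level} (S : SkewField c ℓ) (C : SkewField.Carrier S) {n : ℕ} (P : FinPoset n) where
  open SkewField S
  open FinPoset P
  open PosetOps P
  open PosetFacts P
  open Maps S C P
  open RingSums ring
  open UpChainSums ring P
  open PathSums ring P using (∑ᴾ; fromBottom; fromBottom-rec; weight; cut; upSum-split)
  open SkewFieldInverse S
  open import Relation.Binary.Reasoning.Setoid setoid

  -- a maximal chain through v is cut at v into a chain from 0̂ to v and a chain from v to 1̂
  toggleSum-factor : ∀ h v → toggleSum h v ≈ fromBottom h v * Δ⁻¹ h v
  toggleSum-factor h v = begin
      toggleSum h v
    ≈⟨ ∑-mapMaybe (splitAt v) maxChains (toggleWord h) ⟩
      ∑ maxChains (λ m → maybe (toggleWord h) 0# (splitAt v m))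
    ≈⟨ ∑-cong maxChains toggleWord-cut ⟩
      ∑ maxChains (cut h 1# v)
    ≈⟨ ∑-concatMap (λ x → map (x ∷_) (upChains x)) (filter Minimal? (allFin n)) (cut h 1# v) ⟩
      ∑ (filter Minimal? (allFin n)) (λ x → ∑ (map (x ∷_) (upChains x)) (cut h 1# v))
    ≡⟨ ≡.cong (foldr _+_ 0#) (Listₚ.map-cong (λ x → ∑-map (x ∷_) (upChains x) (cut h 1# v)) (filter Minimal? (allFin n))) ⟩
      ∑ (filter Minimal? (allFin n)) (λ x → upSum x (cut h 1# v))
    ≈⟨ ∑-filter Minimal? (allFin n) _ ⟩
      ∑ᴾ h (λ x → [ Minimal? x ]· upSum x (cut h 1# v))
    ≈⟨ ∑-cong (allFin n) (λ x → guard-cong (Minimal? x) (λ _ → upSum-split h v x 1#)) ⟩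
      ∑ᴾ h (λ x → [ Minimal? x ]· (pathSum x v * (1# * Δ⁻¹ h v)))
    ≈⟨ ∑-cong (allFin n) (λ x → trans (guard-cong (Minimal? x) (λ _ → *-cong refl (*-identityˡ _)))
                                      (sym (guard-*ʳ (Minimal? x) _ _))) ⟩
      ∑ᴾ h (λ x → ([ Minimal? x ]· pathSum x v) * Δ⁻¹ h v)
    ≈⟨ sym (∑-*ʳ _ (allFin n) _) ⟩
      fromBottom h v * Δ⁻¹ h v ∎
    where
    open PathSums ring P h using (pathSum)
    toggleWord-cut : ∀ m → maybe (toggleWord h) 0# (splitAt v m) ≈ cut h 1# v m
    toggleWord-cut m with splitAt v m
    ... | nothing = refl
    ... | just _  = *-cong refl (sym (*-identityˡ _))

  Δ⁻¹-local : ∀ h h′ x → (∀ z → x ≤ z → h z ≡ h′ z) → Δ⁻¹ h x ≈ Δ⁻¹ h′ x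
  Δ⁻¹-local h h′ x h≡h′ = upSum-cong x (weight h) (weight h′) (λ l up →
    reflexive (≡.cong (λ ws → foldr _*_ 1# (reverse ws)) (map-above x l (proj₁ up) h≡h′)))
    where
    map-above : ∀ x l → CoverChain x l → (∀ z → x ≤ z → h z ≡ h′ z) → map h (x ∷ l) ≡ map h′ (x ∷ l)
    map-above x []      _              h≡h′ = ≡.cong [_] (h≡h′ x ≤.refl)
    map-above x (y ∷ l) (x⋖y , chain) h≡h′ = ≡.cong₂ _∷_ (h≡h′ x ≤.refl)
      (map-above y l chain (λ z y≤z → h≡h′ z (≤.trans (proj₁ (⋖⇒< x⋖y)) y≤z)))

  lowerSum-minimal : ∀ f y → Minimal y → lowerSum f y ≈ 1#
  lowerSum-minimal f y min = reflexive
    (≡.cong (λ b → if b then 1# else sumL (map f (filter (_⋖? y) (allFin n)))) (dec-true (Minimal? y) min))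

  lowerSum-covers : ∀ f y → ¬ Minimal y → lowerSum f y ≈ ∑ (allFin n) (λ z → [ z ⋖? y ]· f z)
  lowerSum-covers f y ¬min = trans
    (reflexive (≡.cong (λ b → if b then 1# else sumL (map f (filter (_⋖? y) (allFin n)))) (dec-false (Minimal? y) ¬min)))
    (∑-filter (_⋖? y) (allFin n) f)

  toggle-here : ∀ v h → toggle v h v ≡ C * (toggleSum h v ⁻¹)
  toggle-here v h with v ≟ v
  ... | yes _   = ≡.refl
  ... | no v≢v = ⊥-elim (v≢v ≡.refl)

  toggle-elsewhere : ∀ v h y → y ≢ v → toggle v h y ≡ h y
  toggle-elsewhere v h y y≢v with y ≟ v
  ... | yes y≡v = ⊥-elim (y≢v y≡v)
  ... | no _    = ≡.refl

  Increasing : List (Fin n) → Set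
  Increasing = AllPairs (λ a b → a ≢ b × ¬ (b < a))

  module Target (g : Labeling) (defined : RHSDefined g) where
    R : Labeling
    R = RHS g

    lower : Labeling
    lower = lowerSum (Θ (Δ⁻¹ g))

    R-lower : ∀ z → R z * lower z ≈ Θ (Δ⁻¹ g) z
    R-lower z = trans (*-assoc _ _ _) (trans (*-cong refl (⁻¹-inverseˡ (lower z) (proj₂ defined z))) (*-identityʳ _))

    fromBottom-lower : ∀ h v → (∀ z → z < v → h z ≈ R z) → fromBottom h v ≈ lower v
    fromBottom-lower h = ↓-induction (λ v → (∀ z → z < v → h z ≈ R z) → fromBottom h v ≈ lower v) step
      where
      step : ∀ v → (∀ {y} → y < v → (∀ z → z < y → h z ≈ R z) → fromBottom h y ≈ lower y) →
             (∀ z → z < v → h z ≈ R z) → fromBottom h v ≈ lower v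
      step v ih h≈R with Minimal? v
      ... | yes min = begin
          fromBottom h v
        ≈⟨ fromBottom-rec h v ⟩
          [ Minimal? v ]· 1# + ∑ (allFin n) (λ y → [ y ⋖? v ]· (h y * fromBottom h y))
        ≈⟨ +-cong (guard-yes (Minimal? v) 1# min) (∑-zero (allFin n) (λ y → guard-no (y ⋖? v) _ (λ y⋖v → min y (⋖⇒< y⋖v)))) ⟩
          1# + 0#
        ≈⟨ +-identityʳ 1# ⟩
          1#
        ≈⟨ sym (lowerSum-minimal (Θ (Δ⁻¹ g)) v min) ⟩
          lower v ∎
      ... | no ¬min = begin
          fromBottom h v
        ≈⟨ fromBottom-rec h v ⟩
          [ Minimal? v ]· 1# + ∑ (allFin n) (λ y → [ y ⋖? v ]· (h y * fromBottom h y))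
        ≈⟨ +-cong (guard-no (Minimal? v) 1# ¬min) (∑-cong (allFin n) (λ y → guard-cong (y ⋖? v) (λ y⋖v →
             *-cong (h≈R y (⋖⇒< y⋖v)) (ih (⋖⇒< y⋖v) (λ z z<y → h≈R z (<-trans z<y (⋖⇒< y⋖v))))))) ⟩
          0# + ∑ (allFin n) (λ y → [ y ⋖? v ]· (R y * lower y))
        ≈⟨ +-identityˡ _ ⟩
          ∑ (allFin n) (λ y → [ y ⋖? v ]· (R y * lower y))
        ≈⟨ ∑-cong (allFin n) (λ y → guard-cong (y ⋖? v) (λ _ → R-lower y)) ⟩
          ∑ (allFin n) (λ y → [ y ⋖? v ]· Θ (Δ⁻¹ g) y)
        ≈⟨ sym (lowerSum-covers (Θ (Δ⁻¹ g)) v ¬min) ⟩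
          lower v ∎

    toggle-value : ∀ h v → (∀ z → z < v → h z ≈ R z) → (∀ z → v ≤ z → h z ≡ g z) →
                   C * (toggleSum h v ⁻¹) ≈ R v
    toggle-value h v below above = begin
        C * (toggleSum h v ⁻¹)
      ≈⟨ *-cong refl (⁻¹-cong (trans (toggleSum-factor h v)
           (*-cong (fromBottom-lower h v below) (Δ⁻¹-local h g v above)))) ⟩
        C * ((lower v * Δ⁻¹ g v) ⁻¹)
      ≈⟨ *-cong refl (⁻¹-anti-* (lower v) (Δ⁻¹ g v) (proj₂ defined v) (proj₁ defined v)) ⟩
        C * (Δ⁻¹ g v ⁻¹ * lower v ⁻¹)
      ≈⟨ sym (*-assoc _ _ _) ⟩
        R v ∎

    toggles-correct : ∀ vs h → Increasing vs → (∀ {w z} → w ∈ vs → w < z → z ∈ vs) →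
                      (∀ y → y ∈ vs → h y ≡ g y) → (∀ y → y ∉ vs → h y ≈ R y) →
                      ∀ y → toggles vs h y ≈ R y
    toggles-correct []       h _                upSet onVs offVs y = offVs y (λ ())
    toggles-correct (v ∷ vs) h (v<vs ∷ incr) upSet onVs offVs =
      toggles-correct vs (toggle v h) incr upSet′ onVs′ offVs′
      where
      ≢v : ∀ {y} → y ∈ vs → y ≢ v
      ≢v y∈vs y≡v = proj₁ (ListAll.lookup v<vs y∈vs) (≡.sym y≡v)
      below : ∀ z → z < v → h z ≈ R z
      below z z<v = offVs z (λ { (here z≡v) → proj₂ z<v z≡v ; (there z∈vs) → proj₂ (ListAll.lookup v<vs z∈vs) z<v })
      above : ∀ z → v ≤ z → h z ≡ g z
      above z v≤z with z ≟ v
      ... | yes ≡.refl = onVs z (here ≡.refl)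
      ... | no z≢v     = onVs z (upSet (here ≡.refl) (v≤z , λ v≡z → z≢v (≡.sym v≡z)))
      upSet′ : ∀ {w z} → w ∈ vs → w < z → z ∈ vs
      upSet′ w∈vs w<z with upSet (there w∈vs) w<z
      ... | here ≡.refl  = ⊥-elim (proj₂ (ListAll.lookup v<vs w∈vs) w<z)
      ... | there z∈vs = z∈vs
      onVs′ : ∀ y → y ∈ vs → toggle v h y ≡ g y
      onVs′ y y∈vs = ≡.trans (toggle-elsewhere v h y (≢v y∈vs)) (onVs y (there y∈vs))
      offVs′ : ∀ y → y ∉ vs → toggle v h y ≈ R y
      offVs′ y y∉vs = byCases (y ≟ v)
        where
        byCases : Dec (y ≡ v) → toggle v h y ≈ R y
        byCases (yes ≡.refl) = trans (reflexive (toggle-here y h)) (toggle-value h y below above)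
        byCases (no y≢v)     = trans (reflexive (toggle-elsewhere v h y y≢v))
                                     (offVs y (λ { (here y≡v) → y≢v y≡v ; (there y∈vs) → y∉vs y∈vs }))

  module _ (L : LinearExtension) where
    open LinearExtension L

    toList-complete : ∀ y → y ∈ toList L
    toList-complete y with surj y
    ... | i , ord-i≡y = ≡.subst (_∈ toList L) ord-i≡y (∈-map⁺ ord (∈-allFin i))

    toList-increasing : Increasing (toList L)
    toList-increasing = AllPairsₚ.map⁺ (AllPairsₚ.tabulate⁺-< {f = id} (λ {i} {j} i<j →
      (λ ord-i≡ord-j → <-irrefl (inj ord-i≡ord-j) i<j) , (λ ord-j<ord-i → <-asym i<j (mono j i ord-j<ord-i))))

  NAR≈RHS : ∀ L g → RHSDefined g → ∀ x → NAR L g x ≈ RHS g x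
  NAR≈RHS L g defined = Target.toggles-correct g defined (toList L) g (toList-increasing L)
    (λ {_} {z} _ _ → toList-complete L z) (λ _ _ → ≡.refl) (λ y y∉ → ⊥-elim (y∉ (toList-complete L y)))

theorem5p26 : ∀ {c ℓ k : Level} (S : SkewField c ℓ) → InfiniteSubfield S k →
    (C : SkewField.Carrier S) → Central S C →
    ∀ {n : ℕ} (P : FinPoset n) (L : PosetOps.LinearExtension P)
    (g : Fin n → SkewField.Carrier S) →
    Maps.NARDefined S C P L g → Maps.RHSDefined S C P g →
    ∀ x → SkewField._≈_ S (Maps.NAR S C P L g x) (Maps.RHS S C P g x)
theorem5p26 S _ C _ P L g _ defined = Rowmotion.NAR≈RHS S C P L g defined
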